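{- Let $G=(V,E)$ be a cube-free median graph. Every rooted tree $T$ (subgraph of $G$) with gated branches is quasigated, i.e. every vertex $u\in V\setminus V(T)$ has at most two imprints on $V(T)$.
   Context: $d_G$ is the shortest-path distance, $I(u,v)=\{w: d_G(u,w)+d_G(w,v)=d_G(u,v)\}$. $G$ is median if $I(x,y)\cap I(y,z)\cap I(z,x)$ is a single vertex for all $x,y,z$, and cube-free if it contains no 3-cube $Q_3$. A subgraph $S$ is gated if every vertex $v$ has a vertex $v'\in V(S)$ with $d_G(v,u)=d_G(v,v')+d_G(v',u)$ for all $u\in V(S)$. A tree $T\subseteq G$ with root $r$ has gated branches if for every vertex $w$ of $T$ the unique $(w,r)$-path of $T$ is a gated subgraph of $G$. For a set $A$ and a vertex $u\notin A$, an imprint of $u$ on $A$ is a vertex $a\in A$ with $I(u,a)\cap A=\{a\}$. A set $A$ is quasigated if every $u\notin A$ has at most two imprints on $A$. -}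

module Defs where

open import Data.Nat using (ℕ; zero; suc; _+_; _≤_; _<_)
open import Data.Bool using (Bool; true; false; not)
open import Data.Product using (Σ; ∃; _×_; _,_)
open import Data.Sum using (_⊎_)
open import Relation.Binary.PropositionalEquality using (_≡_; _≢_)
open import Relation.Nullary using (¬_)
open import Function using (_∘_)
open import Function.Definitions using (Injective)

record Graph : Set₁ where
  field
    V      : Set
    Adj    : V → V → Set
    sym    : ∀ {u v} → Adj u v → Adj v u
    irrefl : ∀ {u} → ¬ Adj u u

module _ (G : Graph) where
  open Graph G

  data Walk : V → V → ℕ → Set where
    nil  : ∀ {u} → Walk u u 0
    cons : ∀ {u w v k} → Adj u w → Walk w v k → Walk u v (suc k)

  Dist : V → V → ℕ → Set
  Dist u v k = Walk u v k × (∀ m → Walk u v m → k ≤ m)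

  Interval : V → V → V → Set
  Interval u v w = ∃ λ a → ∃ λ b → ∃ λ c →
    Dist u w a × Dist w v b × Dist u v c × (a + b ≡ c)

  IsMedian : Set
  IsMedian = ∀ x y z → Σ V λ m →
    (Interval x y m × Interval y z m × Interval z x m) ×
    (∀ m' → Interval x y m' → Interval y z m' → Interval z x m' → m' ≡ m)

  Q3 : Set
  Q3 = Bool × Bool × Bool

  data Q3Adj : Q3 → Q3 → Set where
    flip₁ : ∀ a b c → Q3Adj (a , b , c) (not a , b , c)
    flip₂ : ∀ a b c → Q3Adj (a , b , c) (a , not b , c)
    flip₃ : ∀ a b c → Q3Adj (a , b , c) (a , b , not c)

  ContainsQ3 : Set
  ContainsQ3 = Σ (Q3 → V) λ f →
    Injective _≡_ _≡_ f × (∀ p q → Q3Adj p q → Adj (f p) (f q))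

  CubeFree : Set
  CubeFree = ¬ ContainsQ3

  Gated : (V → Set) → Set
  Gated S = ∀ v → Σ V λ v' → S v' × (∀ u → S u → Interval v u v')

  -- rooted tree, a subgraph of G, given by a parent map: every tree vertex
  -- other than the root is G-adjacent to its parent (also in T), and iterating
  -- the parent map from any tree vertex eventually reaches the root.
  iter : (V → V) → ℕ → V → V
  iter f zero    x = x
  iter f (suc n) x = f (iter f n x)

  record RootedTree : Set₁ where
    field
      InT      : V → Set
      root     : V
      root∈T   : InT root
      parent   : V → V
      parent∈T : ∀ w → InT w → w ≢ root → InT (parent w)
      parentAdj : ∀ w → InT w → w ≢ root → Adj w (parent w)
      reaches  : ∀ w → InT w → ∃ λ k → iter parent k w ≡ root

    -- vertex set of the unique (w,r)-path of T: w, parent w, ..., up to the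
    -- first time the root is reached
    Branch : V → V → Set
    Branch w v = ∃ λ i → (v ≡ iter parent i w) ×
                         (∀ j → j < i → iter parent j w ≢ root)

  HasGatedBranches : RootedTree → Set
  HasGatedBranches T = ∀ w → InT w → Gated (Branch w)
    where open RootedTree T

  Imprint : (V → Set) → V → V → Set
  Imprint A u a = A a × Interval u a a × (∀ x → A x → Interval u a x → x ≡ a)

  Quasigated : (V → Set) → Set
  Quasigated A = ∀ u → ¬ A u → ∀ a b c →
    Imprint A u a → Imprint A u b → Imprint A u c →
    (a ≡ b) ⊎ (b ≡ c) ⊎ (a ≡ c)

module Submission where

-- Fix u.  Call a tree vertex w a gate (for u) if u reaches every vertex of the branch of w,
-- i.e. of the path from w to the root, through w: d(u,v) = d(u,w) + d(w,v).  Because branches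
-- are gated, the parent of a gate is again a gate, one step farther from u; an imprint a is a
-- gate (the gate of u in branch(a) lies in I(u,a) ∩ V(T) = {a}), and no imprint lies on the
-- branch of another.  Given three distinct imprints, the branches of two of them merge at a
-- vertex x entered from two distinct children z₁, z₂, and (for a suitable choice of the pair)
-- the branch of the third joins branch(x) through a vertex s off the branches of z₁ and z₂.
-- The median of u, x and s is then a third neighbour of x closer to u than x, and in a median
-- graph a vertex with three neighbours closer to u spans a 3-cube, which is excluded.

open import Defs
open import Data.Bool using (Bool; true; false)
open import Data.Empty using (⊥; ⊥-elim)
open import Data.List using (List; []; _∷_)
open import Data.List.Membership.Propositional using (_∈_)
open import Data.List.Relation.Unary.All using ([]; _∷_; lookup)
open import Data.List.Relation.Unary.AllPairs using (AllPairs; []; _∷_)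
import Data.List.Relation.Unary.Any as Any
open import Data.Nat using (ℕ; zero; suc; _+_; _≤_; _<_; z≤n; s≤s) renaming (_≟_ to _≟ℕ_)
open import Data.Nat.Properties
  using (suc-injective; 1+n≢n; m≢1+n+m; m+1+n≢m; m+1+n≢0; +-suc; +-comm;
         +-cancelˡ-≡; +-cancelʳ-≡; ≤-antisym; n≤0⇒n≡0)
open import Data.Nat.Solver using (module +-*-Solver)
open import Data.Product using (Σ; _×_; _,_; proj₁; proj₂)
open import Data.Sum using (_⊎_; inj₁; inj₂)
open import Function using (_∘_)
open import Function.Definitions using (Injective)
open import Relation.Binary.Definitions using (DecidableEquality)
open import Relation.Binary.PropositionalEquality
  using (_≡_; _≢_; refl; sym; trans; cong; cong₂; subst; ≢-sym; module ≡-Reasoning)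
open import Relation.Nullary using (¬_; Dec; yes; no)

open ≡-Reasoning

sum≡1 : ∀ a b → a + b ≡ 1 → (a ≡ 0 × b ≡ 1) ⊎ (a ≡ 1 × b ≡ 0)
sum≡1 zero b e = inj₁ (refl , e)
sum≡1 (suc zero) zero e = inj₂ (refl , refl)

sum≡2 : ∀ a b → a + b ≡ 2 → a ≡ 0 ⊎ b ≡ 0 ⊎ (a ≡ 1 × b ≡ 1)
sum≡2 zero b e = inj₁ refl
sum≡2 (suc zero) (suc zero) e = inj₂ (inj₂ (refl , refl))
sum≡2 (suc (suc zero)) zero e = inj₂ (inj₁ refl)

pairwise-sums≡2 : ∀ a b c → a + b ≡ 2 → b + c ≡ 2 → c + a ≡ 2 → a ≡ 1 × b ≡ 1 × c ≡ 1
pairwise-sums≡2 zero .2 zero refl refl ()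
pairwise-sums≡2 (suc zero) (suc zero) (suc zero) _ _ _ = refl , refl , refl
pairwise-sums≡2 (suc zero) (suc zero) zero _ () _
pairwise-sums≡2 (suc zero) (suc zero) (suc (suc c)) _ () _
pairwise-sums≡2 (suc (suc zero)) zero .2 _ refl ()

≤1-nonzero : ∀ {n} → n ≤ 1 → n ≢ 0 → n ≡ 1
≤1-nonzero {zero} _ n≢0 = ⊥-elim (n≢0 refl)
≤1-nonzero {suc zero} _ _ = refl
≤1-nonzero {suc (suc n)} (s≤s ())

≤2-above1 : ∀ {n} → n ≤ 2 → n ≢ 0 → n ≢ 1 → n ≡ 2
≤2-above1 {zero} _ n≢0 _ = ⊥-elim (n≢0 refl)
≤2-above1 {suc zero} _ _ n≢1 = ⊥-elim (n≢1 refl)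
≤2-above1 {suc (suc zero)} _ _ _ = refl
≤2-above1 {suc (suc (suc n))} (s≤s (s≤s ()))

double≡2 : ∀ {n} → n + n ≡ 2 → n ≡ 1
double≡2 {suc zero} _ = refl
double≡2 {suc (suc n)} e = ⊥-elim (m+1+n≢0 n (suc-injective (suc-injective e)))

-- The arithmetic of the fork argument: with A = d(u,m), B = d(m,x), C = d(m,s), L = d(u,x)
-- and k = d(x,y), the three interval equations of the median m force B = 1.
fork-arithmetic : ∀ A B C L k → A + B ≡ L → B + C ≡ suc k → suc (C + A) ≡ L + k →
                  B ≡ 1 × suc A ≡ L × C ≡ k
fork-arithmetic A B C L k e₁ e₂ e₃ =
  B≡1 , trans (+-comm 1 A) (subst (λ b → A + b ≡ L) B≡1 e₁) ,
  suc-injective (subst (λ b → b + C ≡ suc k) B≡1 e₂)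
  where
  open +-*-Solver
  twice : (B + B) + (C + A) ≡ 2 + (C + A)
  twice = begin
    (B + B) + (C + A) ≡⟨ solve 3 (λ a b c → (b :+ b) :+ (c :+ a) := (a :+ b) :+ (b :+ c)) refl A B C ⟩
    (A + B) + (B + C) ≡⟨ cong₂ _+_ e₁ e₂ ⟩
    L + suc k         ≡⟨ +-suc L k ⟩
    suc (L + k)       ≡⟨ cong suc (sym e₃) ⟩
    2 + (C + A)       ∎
  B≡1 : B ≡ 1
  B≡1 = double≡2 (+-cancelʳ-≡ (C + A) (B + B) 2 twice)

injective-by-rank : ∀ {A B : Set} (f : A → B) (rank : A → ℕ) {xs : List A} →
                    (∀ p → p ∈ xs) → (∀ {p q} → f p ≡ f q → rank p ≡ rank q) →
                    AllPairs (λ p q → rank p ≡ rank q → f p ≢ f q) xs → Injective _≡_ _≡_ f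
injective-by-rank f rank complete same-rank apart {p} {q} fp≡fq =
  go apart (complete p) (complete q)
  where
  go : ∀ {ys} → AllPairs (λ p q → rank p ≡ rank q → f p ≢ f q) ys → p ∈ ys → q ∈ ys → p ≡ q
  go (_ ∷ _) (Any.here refl) (Any.here refl) = refl
  go (p-apart ∷ _) (Any.here refl) (Any.there q∈) =
    ⊥-elim (lookup p-apart q∈ (same-rank fp≡fq) fp≡fq)
  go (q-apart ∷ _) (Any.there p∈) (Any.here refl) =
    ⊥-elim (lookup q-apart p∈ (same-rank (sym fp≡fq)) (sym fp≡fq))
  go (_ ∷ rest) (Any.there p∈) (Any.there q∈) = go rest p∈ q∈

corners : List (Bool × Bool × Bool)
corners = (true , true , true)
        ∷ (false , true , true) ∷ (true , false , true) ∷ (true , true , false)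
        ∷ (false , false , true) ∷ (false , true , false) ∷ (true , false , false)
        ∷ (false , false , false) ∷ []

corners-complete : ∀ p → p ∈ corners
corners-complete (true , true , true) = Any.here refl
corners-complete (false , true , true) = Any.there (Any.here refl)
corners-complete (true , false , true) = Any.there (Any.there (Any.here refl))
corners-complete (true , true , false) = Any.there (Any.there (Any.there (Any.here refl)))
corners-complete (false , false , true) =
  Any.there (Any.there (Any.there (Any.there (Any.here refl))))
corners-complete (false , true , false) =
  Any.there (Any.there (Any.there (Any.there (Any.there (Any.here refl)))))
corners-complete (true , false , false) =
  Any.there (Any.there (Any.there (Any.there (Any.there (Any.there (Any.here refl))))))
corners-complete (false , false , false) =
  Any.there (Any.there (Any.there (Any.there (Any.there (Any.there (Any.there (Any.here refl)))))))

height : Bool × Bool × Bool → ℕ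
height (a , b , c) = bit a + bit b + bit c
  where
  bit : Bool → ℕ
  bit true = 1
  bit false = 0

module Metric (G : Graph) (isMedian : IsMedian G) where
  open Graph G renaming (sym to adj-sym)

  private
    variable
      x y v w : V
      k n : ℕ

    snoc : Walk G x y k → Adj y v → Walk G x v (suc k)
    snoc nil e = cons e nil
    snoc (cons e ω) e′ = cons e (snoc ω e′)

    reverse : Walk G x y k → Walk G y x k
    reverse nil = nil
    reverse (cons e ω) = snoc (reverse ω) (adj-sym e)

    append : Walk G x y k → Walk G y v n → Walk G x v (k + n)
    append nil ω′ = ω′
    append (cons e ω) ω′ = cons e (append ω ω′)

  median : V → V → V → V
  median x y z = proj₁ (isMedian x y z)

  median-intervals : ∀ x y z → Interval G x y (median x y z) × Interval G y z (median x y z)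
                                × Interval G z x (median x y z)
  median-intervals x y z = proj₁ (proj₂ (isMedian x y z))

  median-unique : ∀ {x y z m} → Interval G x y m → Interval G y z m → Interval G z x m →
                  m ≡ median x y z
  median-unique {x} {y} {z} {m} = proj₂ (proj₂ (isMedian x y z)) m

  -- A median graph is connected: the median of x, y, x lies in I(x,y), and an interval
  -- records the distance between its ends.  This defines the distance function d.
  private
    interval-length : Interval G x y w → ℕ
    interval-length (_ , _ , c , _) = c

    interval-distance : (I : Interval G x y w) → Dist G x y (interval-length I)
    interval-distance (_ , _ , _ , _ , _ , D , _) = D

  d : V → V → ℕ
  d x y = interval-length (proj₁ (median-intervals x y x))

  d-distance : ∀ x y → Dist G x y (d x y)
  d-distance x y = interval-distance (proj₁ (median-intervals x y x))

  geodesic : ∀ x y → Walk G x y (d x y)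
  geodesic x y = proj₁ (d-distance x y)

  d-minimal : Walk G x y k → d x y ≤ k
  d-minimal {x} {y} ω = proj₂ (d-distance x y) _ ω

  distance-unique : Dist G x y k → k ≡ d x y
  distance-unique D = ≤-antisym (proj₂ D _ (geodesic _ _)) (d-minimal (proj₁ D))

  interval⇒sum : Interval G x y w → d x w + d w y ≡ d x y
  interval⇒sum (_ , _ , _ , D₁ , D₂ , D₃ , e) =
    trans (cong₂ _+_ (sym (distance-unique D₁)) (sym (distance-unique D₂)))
          (trans e (distance-unique D₃))

  sum⇒interval : ∀ {x y w} → d x w + d w y ≡ d x y → Interval G x y w
  sum⇒interval {x} {y} {w} e = _ , _ , _ , d-distance x w , d-distance w y , d-distance x y , e

  d-sym : ∀ x y → d x y ≡ d y x
  d-sym x y = ≤-antisym (d-minimal (reverse (geodesic y x))) (d-minimal (reverse (geodesic x y)))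

  d-triangle : ∀ x y z → d x z ≤ d x y + d y z
  d-triangle x y z = d-minimal (append (geodesic x y) (geodesic y z))

  interval-sym : ∀ {x y w} → Interval G x y w → Interval G y x w
  interval-sym {x} {y} {w} I = sum⇒interval (begin
    d y w + d w x ≡⟨ cong₂ _+_ (d-sym y w) (d-sym w x) ⟩
    d w y + d x w ≡⟨ +-comm (d w y) (d x w) ⟩
    d x w + d w y ≡⟨ interval⇒sum I ⟩
    d x y         ≡⟨ d-sym x y ⟩
    d y x         ∎)

  d-zero : ∀ {x y} → d x y ≡ 0 → x ≡ y
  d-zero {x} {y} e with subst (Walk G x y) e (geodesic x y)
  ... | nil = refl

  d-refl : ∀ x → d x x ≡ 0
  d-refl x = n≤0⇒n≡0 (d-minimal nil)

  d-one : ∀ {x y} → d x y ≡ 1 → Adj x y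
  d-one {x} {y} e with subst (Walk G x y) e (geodesic x y)
  ... | cons a nil = a

  d-adj : ∀ {x y} → Adj x y → d x y ≡ 1
  d-adj {x} a = ≤1-nonzero (d-minimal (cons a nil)) (λ e → irrefl (subst (Adj x) (sym (d-zero e)) a))

  _≟_ : DecidableEquality V
  x ≟ y with d x y ≟ℕ 0
  ... | yes e = yes (d-zero e)
  ... | no e≢0 = no (λ { refl → e≢0 (d-refl x) })

  d-two : ∀ {x y w} → x ≢ y → ¬ Adj x y → Adj x w → Adj w y → d x y ≡ 2
  d-two {x} {y} {w} x≢y x≁y a₁ a₂ =
    ≤2-above1 (subst (d x y ≤_) (cong₂ _+_ (d-adj a₁) (d-adj a₂)) (d-triangle x w y))
              (x≢y ∘ d-zero) (x≁y ∘ d-one)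

  edge-interval : ∀ {x y w} → Adj x y → Interval G x y w → w ≡ x ⊎ w ≡ y
  edge-interval a I with sum≡1 _ _ (trans (interval⇒sum I) (d-adj a))
  ... | inj₁ (e , _) = inj₁ (sym (d-zero e))
  ... | inj₂ (_ , e) = inj₂ (d-zero e)

  common-neighbour-interval : ∀ {x y w} → d x y ≡ 2 → Adj x w → Adj w y → Interval G x y w
  common-neighbour-interval e a₁ a₂ = sum⇒interval (trans (cong₂ _+_ (d-adj a₁) (d-adj a₂)) (sym e))

  module Triangle {x y z} (dxy : d x y ≡ 2) (dyz : d y z ≡ 2) (dzx : d z x ≡ 2) where
    centre : V
    centre = median x y z

    centre-adjacent : Adj x centre × Adj y centre × Adj z centre
    centre-adjacent with median-intervals x y z
    ... | Ixy , Iyz , Izx with pairwise-sums≡2 (d x centre) (d centre y) (d centre z)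
          (trans (interval⇒sum Ixy) dxy)
          (trans (cong (_+ d centre z) (d-sym centre y)) (trans (interval⇒sum Iyz) dyz))
          (trans (cong₂ _+_ (d-sym centre z) (d-sym x centre)) (trans (interval⇒sum Izx) dzx))
    ... | dxc , dcy , dcz =
      d-one dxc , d-one (trans (d-sym y centre) dcy) , d-one (trans (d-sym z centre) dcz)

    centre-unique : ∀ {w} → Adj w x → Adj w y → Adj w z → w ≡ centre
    centre-unique wx wy wz =
      median-unique (common-neighbour-interval dxy (adj-sym wx) wy)
                    (common-neighbour-interval dyz (adj-sym wy) wz)
                    (common-neighbour-interval dzx (adj-sym wz) wx)

  module Levels (u : V) where

    _⋖_ : V → V → Set
    a ⋖ b = Adj a b × suc (d u a) ≡ d u b

    ⋖-interval : ∀ {a b} → a ⋖ b → Interval G u b a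
    ⋖-interval {a} {b} (ab , level) = sum⇒interval (begin
      d u a + d a b ≡⟨ cong (d u a +_) (d-adj ab) ⟩
      d u a + 1     ≡⟨ +-comm (d u a) 1 ⟩
      suc (d u a)   ≡⟨ level ⟩
      d u b         ∎)

    interval-⋖ : ∀ {a b} → Adj a b → Interval G u b a → a ⋖ b
    interval-⋖ {a} {b} ab I = ab , (begin
      suc (d u a)   ≡⟨ +-comm 1 (d u a) ⟩
      d u a + 1     ≡⟨ cong (d u a +_) (sym (d-adj ab)) ⟩
      d u a + d a b ≡⟨ interval⇒sum I ⟩
      d u b         ∎)

    -- Median graphs are bipartite: the ends of an edge lie on consecutive levels, since the
    -- median of x, y, u is x or y.
    edge-levels : ∀ {x y} → Adj x y → x ⋖ y ⊎ y ⋖ x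
    edge-levels {x} {y} xy with median-intervals x y u
    ... | Ixy , Iyu , Iux with edge-interval xy Ixy
    ... | inj₁ m≡x = inj₁ (interval-⋖ xy (interval-sym (subst (Interval G y u) m≡x Iyu)))
    ... | inj₂ m≡y = inj₂ (interval-⋖ (adj-sym xy) (subst (Interval G u x) m≡y Iux))

    same-level-apart : ∀ {x y} → d u x ≡ d u y → ¬ Adj x y
    same-level-apart e xy with edge-levels xy
    ... | inj₁ (_ , level) = 1+n≢n (trans level (sym e))
    ... | inj₂ (_ , level) = 1+n≢n (trans level e)

    ⋖-co-level : ∀ {a b c} → a ⋖ c → b ⋖ c → d u a ≡ d u b
    ⋖-co-level (_ , l₁) (_ , l₂) = suc-injective (trans l₁ (sym l₂))

    ⋖⋖-apart : ∀ {a b c} → a ⋖ b → b ⋖ c → a ≢ c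
    ⋖⋖-apart {a} (_ , l₁) (_ , l₂) refl = m≢1+n+m (d u a) (sym (trans (cong suc l₁) l₂))

    level-d-two : ∀ {x y w} → d u x ≡ d u y → x ≢ y → Adj x w → Adj w y → d x y ≡ 2
    level-d-two e x≢y = d-two x≢y (same-level-apart e)

    d-siblings : ∀ {p q y} → p ⋖ y → q ⋖ y → p ≢ q → d p q ≡ 2
    d-siblings py qy p≢q = level-d-two (⋖-co-level py qy) p≢q (proj₁ py) (adj-sym (proj₁ qy))

    -- Two vertices of the same level at distance 2 have a common neighbour one level closer
    -- to u, namely their median with u, and it is the only one.
    lower-common-neighbour : ∀ {p q} → d p q ≡ 2 → d u p ≡ d u q → Σ V λ m → m ⋖ p × m ⋖ q
    lower-common-neighbour {p} {q} dpq level with median-intervals p q u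
    ... | Ipq , Iqu , Iup with sum≡2 (d p (median p q u)) (d (median p q u) q) (trans (interval⇒sum Ipq) dpq)
    ... | inj₁ dpm≡0 = ⊥-elim (m≢1+n+m (d u p) (begin
      d u p         ≡⟨ level ⟩
      d u q         ≡⟨ d-sym u q ⟩
      d q u         ≡⟨ sym (interval⇒sum (subst (Interval G q u) (sym (d-zero dpm≡0)) Iqu)) ⟩
      d q p + d p u ≡⟨ cong₂ _+_ (trans (d-sym q p) dpq) (d-sym p u) ⟩
      2 + d u p     ∎))
    ... | inj₂ (inj₁ dmq≡0) = ⊥-elim (m+1+n≢m (d u p) (sym (begin
      d u p         ≡⟨ sym (interval⇒sum (subst (Interval G u p) (d-zero dmq≡0) Iup)) ⟩
      d u q + d q p ≡⟨ cong₂ _+_ (sym level) (trans (d-sym q p) dpq) ⟩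
      d u p + 2     ∎)))
    ... | inj₂ (inj₂ (dpm≡1 , dmq≡1)) =
      median p q u ,
      interval-⋖ (adj-sym (d-one dpm≡1)) Iup ,
      interval-⋖ (d-one dmq≡1) (interval-sym Iqu)

    lower-common-neighbour-unique : ∀ {p q m m′} → d p q ≡ 2 → m ⋖ p → m ⋖ q → m′ ⋖ p → m′ ⋖ q →
                                    m ≡ m′
    lower-common-neighbour-unique {p} {q} dpq mp mq m′p m′q =
      trans (is-median mp mq) (sym (is-median m′p m′q))
      where
      is-median : ∀ {m} → m ⋖ p → m ⋖ q → m ≡ median p q u
      is-median mp mq = median-unique (common-neighbour-interval dpq (adj-sym (proj₁ mp)) (proj₁ mq))
                                      (interval-sym (⋖-interval mq)) (⋖-interval mp)

    -- Two distinct lower neighbours p, q determine the vertex above them (G has no K₂,₃).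
    upper-unique : ∀ {p q a b} → p ⋖ a → q ⋖ a → p ⋖ b → q ⋖ b → p ≢ q → a ≡ b
    upper-unique {p} {q} {a} {b} pa qa pb qb p≢q with a ≟ b
    ... | yes a≡b = a≡b
    ... | no a≢b = ⊥-elim (p≢q (lower-common-neighbour-unique dab pa pb qa qb))
      where
      dab : d a b ≡ 2
      dab = level-d-two (trans (sym (proj₂ pa)) (proj₂ pb)) a≢b (adj-sym (proj₁ pa)) (proj₁ pb)

    module GradedCube {y y₁ y₂ y₃ m₁₂ m₁₃ m₂₃ z : V}
        (y₁⋖y : y₁ ⋖ y) (y₂⋖y : y₂ ⋖ y) (y₃⋖y : y₃ ⋖ y)
        (m₁₂⋖y₁ : m₁₂ ⋖ y₁) (m₁₂⋖y₂ : m₁₂ ⋖ y₂) (m₁₃⋖y₁ : m₁₃ ⋖ y₁)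
        (m₁₃⋖y₃ : m₁₃ ⋖ y₃) (m₂₃⋖y₂ : m₂₃ ⋖ y₂) (m₂₃⋖y₃ : m₂₃ ⋖ y₃)
        (z⋖m₁₂ : z ⋖ m₁₂) (z⋖m₁₃ : z ⋖ m₁₃) (z⋖m₂₃ : z ⋖ m₂₃)
        (y₁≢y₂ : y₁ ≢ y₂) (y₁≢y₃ : y₁ ≢ y₃) (y₂≢y₃ : y₂ ≢ y₃)
        (m₁₂≢m₁₃ : m₁₂ ≢ m₁₃) (m₁₂≢m₂₃ : m₁₂ ≢ m₂₃) (m₁₃≢m₂₃ : m₁₃ ≢ m₂₃) where

      -- Coordinate i of a corner is false when the corner lies on the side of yᵢ.
      corner : Q3 G → V
      corner (true , true , true) = y
      corner (false , true , true) = y₁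
      corner (true , false , true) = y₂
      corner (true , true , false) = y₃
      corner (false , false , true) = m₁₂
      corner (false , true , false) = m₁₃
      corner (true , false , false) = m₂₃
      corner (false , false , false) = z

      descend₁ : ∀ b c → corner (false , b , c) ⋖ corner (true , b , c)
      descend₁ true true = y₁⋖y
      descend₁ true false = m₁₃⋖y₃
      descend₁ false true = m₁₂⋖y₂
      descend₁ false false = z⋖m₂₃

      descend₂ : ∀ a c → corner (a , false , c) ⋖ corner (a , true , c)
      descend₂ true true = y₂⋖y
      descend₂ true false = m₂₃⋖y₃
      descend₂ false true = m₁₂⋖y₁
      descend₂ false false = z⋖m₁₃

      descend₃ : ∀ a b → corner (a , b , false) ⋖ corner (a , b , true)
      descend₃ true true = y₃⋖y
      descend₃ true false = m₂₃⋖y₂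
      descend₃ false true = m₁₃⋖y₁
      descend₃ false false = z⋖m₁₂

      edges : ∀ p q → Q3Adj G p q → Adj (corner p) (corner q)
      edges _ _ (flip₁ true b c) = adj-sym (proj₁ (descend₁ b c))
      edges _ _ (flip₁ false b c) = proj₁ (descend₁ b c)
      edges _ _ (flip₂ a true c) = adj-sym (proj₁ (descend₂ a c))
      edges _ _ (flip₂ a false c) = proj₁ (descend₂ a c)
      edges _ _ (flip₃ a b true) = adj-sym (proj₁ (descend₃ a b))
      edges _ _ (flip₃ a b false) = proj₁ (descend₃ a b)

      rise : ∀ {a b n} → a ⋖ b → d u a ≡ n → d u b ≡ suc n
      rise (_ , level) e = trans (sym level) (cong suc e)

      corner-level : ∀ p → d u (corner p) ≡ height p + d u z
      corner-level (false , false , false) = refl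
      corner-level (false , false , true) = rise z⋖m₁₂ refl
      corner-level (false , true , false) = rise z⋖m₁₃ refl
      corner-level (true , false , false) = rise z⋖m₂₃ refl
      corner-level (false , true , true) = rise m₁₂⋖y₁ (rise z⋖m₁₂ refl)
      corner-level (true , false , true) = rise m₁₂⋖y₂ (rise z⋖m₁₂ refl)
      corner-level (true , true , false) = rise m₁₃⋖y₃ (rise z⋖m₁₃ refl)
      corner-level (true , true , true) = rise y₁⋖y (rise m₁₂⋖y₁ (rise z⋖m₁₂ refl))

      same-height : ∀ {p q} → corner p ≡ corner q → height p ≡ height q
      same-height {p} {q} e =
        +-cancelʳ-≡ (d u z) (height p) (height q)
          (trans (sym (corner-level p)) (trans (cong (d u) e) (corner-level q)))

      -- Corners of distinct heights are separated by their levels; within a height the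
      -- distinctness is assumed.
      apart : AllPairs (λ p q → height p ≡ height q → corner p ≢ corner q) corners
      apart = ((λ ()) ∷ (λ ()) ∷ (λ ()) ∷ (λ ()) ∷ (λ ()) ∷ (λ ()) ∷ (λ ()) ∷ [])
            ∷ ((λ _ → y₁≢y₂) ∷ (λ _ → y₁≢y₃) ∷ (λ ()) ∷ (λ ()) ∷ (λ ()) ∷ (λ ()) ∷ [])
            ∷ ((λ _ → y₂≢y₃) ∷ (λ ()) ∷ (λ ()) ∷ (λ ()) ∷ (λ ()) ∷ [])
            ∷ ((λ ()) ∷ (λ ()) ∷ (λ ()) ∷ (λ ()) ∷ [])
            ∷ ((λ _ → m₁₂≢m₁₃) ∷ (λ _ → m₁₂≢m₂₃) ∷ (λ ()) ∷ [])
            ∷ ((λ _ → m₁₃≢m₂₃) ∷ (λ ()) ∷ [])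
            ∷ ((λ ()) ∷ [])
            ∷ []
            ∷ []

      contains-Q3 : ContainsQ3 G
      contains-Q3 = corner , injective-by-rank corner height corners-complete same-height apart , edges

    square-below : ∀ {p q y} → p ⋖ y → q ⋖ y → p ≢ q → Σ V λ m → m ⋖ p × m ⋖ q
    square-below py qy p≢q = lower-common-neighbour (d-siblings py qy p≢q) (⋖-co-level py qy)

    -- Downward cube property: a vertex with three distinct neighbours closer to u spans a
    -- 3-cube.  The three squares below y give m₁₂, m₁₃, m₂₃; their median z is the bottom.
    downward-cube : ∀ {y y₁ y₂ y₃} → y₁ ⋖ y → y₂ ⋖ y → y₃ ⋖ y →
                    y₁ ≢ y₂ → y₁ ≢ y₃ → y₂ ≢ y₃ → ContainsQ3 G
    downward-cube {y} {y₁} {y₂} {y₃} y₁⋖y y₂⋖y y₃⋖y y₁≢y₂ y₁≢y₃ y₂≢y₃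
      with square-below y₁⋖y y₂⋖y y₁≢y₂ | square-below y₁⋖y y₃⋖y y₁≢y₃
         | square-below y₂⋖y y₃⋖y y₂≢y₃
    ... | m₁₂ , m₁₂⋖y₁ , m₁₂⋖y₂ | m₁₃ , m₁₃⋖y₁ , m₁₃⋖y₃ | m₂₃ , m₂₃⋖y₂ , m₂₃⋖y₃ =
      GradedCube.contains-Q3 y₁⋖y y₂⋖y y₃⋖y m₁₂⋖y₁ m₁₂⋖y₂ m₁₃⋖y₁ m₁₃⋖y₃ m₂₃⋖y₂ m₂₃⋖y₃
        z⋖m₁₂ z⋖m₁₃ z⋖m₂₃ y₁≢y₂ y₁≢y₃ y₂≢y₃ m₁₂≢m₁₃ m₁₂≢m₂₃ m₁₃≢m₂₃
      where
      module Top = Triangle (d-siblings y₁⋖y y₂⋖y y₁≢y₂) (d-siblings y₂⋖y y₃⋖y y₂≢y₃)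
                            (d-siblings y₃⋖y y₁⋖y (≢-sym y₁≢y₃))

      apex-unique : ∀ {w} → Adj w y₁ → Adj w y₂ → Adj w y₃ → w ≡ y
      apex-unique w₁ w₂ w₃ =
        trans (Top.centre-unique w₁ w₂ w₃)
              (sym (Top.centre-unique (adj-sym (proj₁ y₁⋖y)) (adj-sym (proj₁ y₂⋖y)) (adj-sym (proj₁ y₃⋖y))))

      -- A vertex two levels below y is not adjacent to all of y₁, y₂, y₃.
      m₁₂≢m₁₃ : m₁₂ ≢ m₁₃
      m₁₂≢m₁₃ e = ⋖⋖-apart m₁₂⋖y₁ y₁⋖y
        (apex-unique (proj₁ m₁₂⋖y₁) (proj₁ m₁₂⋖y₂) (subst (λ v → Adj v y₃) (sym e) (proj₁ m₁₃⋖y₃)))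

      m₁₂≢m₂₃ : m₁₂ ≢ m₂₃
      m₁₂≢m₂₃ e = ⋖⋖-apart m₁₂⋖y₁ y₁⋖y
        (apex-unique (proj₁ m₁₂⋖y₁) (proj₁ m₁₂⋖y₂) (subst (λ v → Adj v y₃) (sym e) (proj₁ m₂₃⋖y₃)))

      m₁₃≢m₂₃ : m₁₃ ≢ m₂₃
      m₁₃≢m₂₃ e = ⋖⋖-apart m₁₃⋖y₁ y₁⋖y
        (apex-unique (proj₁ m₁₃⋖y₁) (subst (λ v → Adj v y₂) (sym e) (proj₁ m₂₃⋖y₂)) (proj₁ m₁₃⋖y₃))

      module Bottom = Triangle (d-siblings m₁₂⋖y₁ m₁₃⋖y₁ m₁₂≢m₁₃) (d-siblings m₁₃⋖y₃ m₂₃⋖y₃ m₁₃≢m₂₃)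
                               (d-siblings m₂₃⋖y₂ m₁₂⋖y₂ (≢-sym m₁₂≢m₂₃))
      z : V
      z = Bottom.centre

      m₁₂~z : Adj m₁₂ z
      m₁₂~z = proj₁ Bottom.centre-adjacent

      m₁₃~z : Adj m₁₃ z
      m₁₃~z = proj₁ (proj₂ Bottom.centre-adjacent)

      m₂₃~z : Adj m₂₃ z
      m₂₃~z = proj₂ (proj₂ Bottom.centre-adjacent)

      -- z lies below m₁₂: otherwise z would have the lower neighbours m₁₂, m₁₃ of y₁, so
      -- z = y₁, making m₂₃ a common neighbour of y₁, y₂, y₃.
      z⋖m₁₂ : z ⋖ m₁₂
      z⋖m₁₂ with edge-levels m₁₂~z
      ... | inj₂ z⋖m = z⋖m
      ... | inj₁ m₁₂⋖z = ⊥-elim (⋖⋖-apart m₂₃⋖y₂ y₂⋖y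
              (apex-unique (subst (Adj m₂₃) z≡y₁ m₂₃~z) (proj₁ m₂₃⋖y₂) (proj₁ m₂₃⋖y₃)))
        where
        m₁₃⋖z : m₁₃ ⋖ z
        m₁₃⋖z = m₁₃~z , trans (cong suc (⋖-co-level m₁₃⋖y₁ m₁₂⋖y₁)) (proj₂ m₁₂⋖z)
        z≡y₁ : z ≡ y₁
        z≡y₁ = upper-unique m₁₂⋖z m₁₃⋖z m₁₂⋖y₁ m₁₃⋖y₁ m₁₂≢m₁₃

      z⋖m₁₃ : z ⋖ m₁₃
      z⋖m₁₃ = adj-sym m₁₃~z , trans (proj₂ z⋖m₁₂) (⋖-co-level m₁₂⋖y₁ m₁₃⋖y₁)

      z⋖m₂₃ : z ⋖ m₂₃
      z⋖m₂₃ = adj-sym m₂₃~z , trans (proj₂ z⋖m₁₂) (⋖-co-level m₁₂⋖y₂ m₂₃⋖y₂)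

module Branches (G : Graph) (_≟_ : DecidableEquality (Graph.V G)) (T : RootedTree G) where
  open Graph G using (V)
  open RootedTree T

  data _⇝_ : V → V → Set where
    here : ∀ {w} → w ⇝ w
    up   : ∀ {w v} → w ≢ root → parent w ⇝ v → w ⇝ v

  iter-suc : ∀ i w → iter G parent (suc i) w ≡ iter G parent i (parent w)
  iter-suc zero w = refl
  iter-suc (suc i) w = cong parent (iter-suc i w)

  Branch⇒⇝ : ∀ {w v} → Branch w v → w ⇝ v
  Branch⇒⇝ (i , e , avoid) = go i e avoid
    where
    go : ∀ i {w v} → v ≡ iter G parent i w → (∀ j → j < i → iter G parent j w ≢ root) → w ⇝ v
    go zero refl _ = here
    go (suc i) {w} e avoid =
      up (avoid 0 (s≤s z≤n))
         (go i (trans e (iter-suc i w)) λ j j<i → avoid (suc j) (s≤s j<i) ∘ trans (iter-suc j w))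

  ⇝⇒Branch : ∀ {w v} → w ⇝ v → Branch w v
  ⇝⇒Branch here = 0 , refl , λ _ ()
  ⇝⇒Branch {w} (up w≢r pw⇝v) with ⇝⇒Branch pw⇝v
  ... | i , e , avoid = suc i , trans e (sym (iter-suc i w)) , avoid′
    where
    avoid′ : ∀ j → j < suc i → iter G parent j w ≢ root
    avoid′ zero _ = w≢r
    avoid′ (suc j) (s≤s j<i) e′ = avoid j j<i (trans (sym (iter-suc j w)) e′)

  ⇝-trans : ∀ {w v x} → w ⇝ v → v ⇝ x → w ⇝ x
  ⇝-trans here v⇝x = v⇝x
  ⇝-trans (up w≢r b) v⇝x = up w≢r (⇝-trans b v⇝x)

  ⇝-parent : ∀ {w z} → w ⇝ z → z ≢ root → w ⇝ parent z
  ⇝-parent w⇝z z≢r = ⇝-trans w⇝z (up z≢r here)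

  ⇝-step : ∀ {w v} → w ⇝ v → v ≡ w ⊎ (w ≢ root × parent w ⇝ v)
  ⇝-step here = inj₁ refl
  ⇝-step (up w≢r b) = inj₂ (w≢r , b)

  ⇝-linear : ∀ {a v w} → a ⇝ v → a ⇝ w → v ⇝ w ⊎ w ⇝ v
  ⇝-linear here a⇝w = inj₁ a⇝w
  ⇝-linear (up a≢r b) here = inj₂ (up a≢r b)
  ⇝-linear (up _ bv) (up _ bw) = ⇝-linear bv bw

  ⇝-InT : ∀ {w v} → InT w → w ⇝ v → InT v
  ⇝-InT w∈T here = w∈T
  ⇝-InT {w} w∈T (up w≢r b) = ⇝-InT (parent∈T w w∈T w≢r) b

  ⇝-root : ∀ {w} → InT w → w ⇝ root
  ⇝-root {w} w∈T = go (proj₁ (reaches w w∈T)) w (proj₂ (reaches w w∈T))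
    where
    go : ∀ k w → iter G parent k w ≡ root → w ⇝ root
    go k w e with w ≟ root
    ... | yes refl = here
    go zero w e | no w≢r = ⊥-elim (w≢r e)
    go (suc k) w e | no w≢r = up w≢r (go k (parent w) (trans (sym (iter-suc k w)) e))

  ⇝-dec : ∀ {w} → InT w → ∀ v → Dec (w ⇝ v)
  ⇝-dec {w} w∈T v = go (proj₁ (reaches w w∈T)) w (proj₂ (reaches w w∈T))
    where
    go : ∀ k w → iter G parent k w ≡ root → Dec (w ⇝ v)
    go k w e with v ≟ w
    ... | yes refl = yes here
    ... | no v≢w with w ≟ root
    ...   | yes refl = no λ { here → v≢w refl ; (up r≢r _) → r≢r refl }
    go zero w e | no v≢w | no w≢r = ⊥-elim (w≢r e)
    go (suc k) w e | no v≢w | no w≢r with go k (parent w) (trans (sym (iter-suc k w)) e)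
    ... | yes b = yes (up w≢r b)
    ... | no ¬b = no λ { here → v≢w refl ; (up _ b) → ¬b b }

  -- Acyclicity: a vertex other than the root does not lie on the branch of its parent, for
  -- then iterating the parent map from it would never reach the root.
  parent-not-below : ∀ {w} → InT w → w ≢ root → ¬ (parent w ⇝ w)
  parent-not-below {w} w∈T w≢r pw⇝w = never-root (proj₁ (reaches w w∈T)) w≢r pw⇝w (proj₂ (reaches w w∈T))
    where
    cycle-step : ∀ {v} → v ≢ root → parent v ⇝ v → parent v ≢ root × parent (parent v) ⇝ parent v
    cycle-step {v} v≢r pv⇝v with ⇝-step pv⇝v
    ... | inj₁ v≡pv = v≢r ∘ trans v≡pv , subst (λ x → parent x ⇝ x) v≡pv pv⇝v
    ... | inj₂ (pv≢r , ppv⇝v) = pv≢r , ⇝-parent ppv⇝v v≢r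

    never-root : ∀ k {v} → v ≢ root → parent v ⇝ v → iter G parent k v ≢ root
    never-root zero v≢r _ = v≢r
    never-root (suc k) {v} v≢r pv⇝v =
      never-root k (proj₁ (cycle-step v≢r pv⇝v)) (proj₂ (cycle-step v≢r pv⇝v)) ∘ trans (sym (iter-suc k v))

  sibling-below : ∀ {z z′} → InT z′ → z′ ≢ root → parent z ≡ parent z′ → z ⇝ z′ → z ≡ z′
  sibling-below z′∈T z′≢r e z⇝z′ with ⇝-step z⇝z′
  ... | inj₁ z′≡z = sym z′≡z
  ... | inj₂ (_ , pz⇝z′) = ⊥-elim (parent-not-below z′∈T z′≢r (subst (_⇝ _) e pz⇝z′))

  siblings-on-branch : ∀ {a z z′} → InT a → a ⇝ z → a ⇝ z′ → z ≢ root → z′ ≢ root →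
                       parent z ≡ parent z′ → z ≡ z′
  siblings-on-branch a∈T a⇝z a⇝z′ z≢r z′≢r e with ⇝-linear a⇝z a⇝z′
  ... | inj₁ z⇝z′ = sibling-below (⇝-InT a∈T a⇝z′) z′≢r e z⇝z′
  ... | inj₂ z′⇝z = sym (sibling-below (⇝-InT a∈T a⇝z) z≢r (sym e) z′⇝z)

  exit : ∀ {w₁ w₂} → InT w₂ → InT w₁ → ¬ w₂ ⇝ w₁ →
         Σ V λ s → w₁ ⇝ s × ¬ w₂ ⇝ s × s ≢ root × w₂ ⇝ parent s
  exit {w₁} {w₂} w₂∈T w₁∈T = go (proj₁ (reaches w₁ w₁∈T)) (proj₂ (reaches w₁ w₁∈T))
    where
    go : ∀ k {w} → iter G parent k w ≡ root → ¬ w₂ ⇝ w →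
         Σ V λ s → w ⇝ s × ¬ w₂ ⇝ s × s ≢ root × w₂ ⇝ parent s
    go k {w} e w∉ with w ≟ root
    ... | yes refl = ⊥-elim (w∉ (⇝-root w₂∈T))
    go zero e w∉ | no w≢r = ⊥-elim (w≢r e)
    go (suc k) {w} e w∉ | no w≢r with ⇝-dec w₂∈T (parent w)
    ... | yes pw∈ = w , here , w∉ , w≢r , pw∈
    ... | no pw∉ with go k (trans (sym (iter-suc k w)) e) pw∉
    ... | s , pw⇝s , rest = s , up w≢r pw⇝s , rest

  child-towards : ∀ {w v} → w ⇝ v → v ≢ w → Σ V λ z → w ⇝ z × z ≢ root × parent z ≡ v
  child-towards here v≢w = ⊥-elim (v≢w refl)
  child-towards {w} {v} (up w≢r b) v≢w with v ≟ parent w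
  ... | yes v≡pw = w , here , w≢r , sym v≡pw
  ... | no v≢pw with child-towards b v≢pw
  ... | z , pw⇝z , z≢r , pz≡v = z , up w≢r pw⇝z , z≢r , pz≡v

module Gates (G : Graph) (isMedian : IsMedian G) (T : RootedTree G) (gated : HasGatedBranches G T)
             (u : Graph.V G) where
  open Graph G renaming (sym to adj-sym)
  open Metric G isMedian
  open Levels u
  open RootedTree T
  open Branches G _≟_ T

  IsGate : V → Set
  IsGate w = ∀ v → w ⇝ v → d u v ≡ d u w + d w v

  -- The gate in branch(w) of a vertex s outside it is any vertex t of branch(w) adjacent to s.
  outside-neighbour-gate : ∀ {w s t} → InT w → ¬ w ⇝ s → w ⇝ t → Adj s t →
                           ∀ v → w ⇝ v → d s v ≡ suc (d t v)
  outside-neighbour-gate {w} {s} {t} w∈T s∉ w⇝t s~t v w⇝v with gated w w∈T s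
  ... | g , g∈ , g-gate with sum≡1 (d s g) (d g t) (trans (interval⇒sum (g-gate t (⇝⇒Branch w⇝t))) (d-adj s~t))
  ... | inj₁ (dsg≡0 , _) = ⊥-elim (s∉ (subst (w ⇝_) (sym (d-zero dsg≡0)) (Branch⇒⇝ g∈)))
  ... | inj₂ (dsg≡1 , dgt≡0) with d-zero dgt≡0
  ... | refl = trans (sym (interval⇒sum (g-gate v (⇝⇒Branch w⇝v)))) (cong (_+ d g v) dsg≡1)

  IsGate-⋖ : ∀ {w} → InT w → w ≢ root → IsGate w → w ⋖ parent w
  IsGate-⋖ {w} w∈T w≢r g =
    interval-⋖ (parentAdj w w∈T w≢r) (sum⇒interval (sym (g (parent w) (up w≢r here))))

  IsGate-parent : ∀ {w} → InT w → w ≢ root → IsGate w → IsGate (parent w)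
  IsGate-parent {w} w∈T w≢r g v pw⇝v = begin
    d u v                           ≡⟨ g v (up w≢r pw⇝v) ⟩
    d u w + d w v                   ≡⟨ cong (d u w +_) (outside-neighbour-gate (parent∈T w w∈T w≢r)
                                         (parent-not-below w∈T w≢r) here (parentAdj w w∈T w≢r) v pw⇝v) ⟩
    d u w + suc (d (parent w) v)    ≡⟨ +-suc (d u w) (d (parent w) v) ⟩
    suc (d u w) + d (parent w) v    ≡⟨ cong (_+ d (parent w) v) (proj₂ (IsGate-⋖ w∈T w≢r g)) ⟩
    d u (parent w) + d (parent w) v ∎

  IsGate-⇝ : ∀ {w v} → InT w → IsGate w → w ⇝ v → IsGate v
  IsGate-⇝ w∈T g here = g
  IsGate-⇝ {w} w∈T g (up w≢r b) = IsGate-⇝ (parent∈T w w∈T w≢r) (IsGate-parent w∈T w≢r g) b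

  Imp : V → Set
  Imp = Imprint G InT u

  -- An imprint a is a gate: the gate of u in branch(a) lies in I(u,a) ∩ V(T) = {a}.
  Imprint-IsGate : ∀ {a} → Imp a → IsGate a
  Imprint-IsGate {a} (a∈T , _ , only-a) v a⇝v with gated a a∈T u
  ... | g , g∈ , g-gate with only-a g (⇝-InT a∈T (Branch⇒⇝ g∈)) (g-gate a (⇝⇒Branch here))
  ... | refl = sym (interval⇒sum (g-gate v (⇝⇒Branch a⇝v)))

  Imprint-minimal : ∀ {a w} → Imp a → InT w → IsGate w → w ⇝ a → w ≡ a
  Imprint-minimal (_ , _ , only-a) w∈T g w⇝a = only-a _ w∈T (sum⇒interval (sym (g _ w⇝a)))

  imprints-incomparable : ∀ {a b} → Imp a → Imp b → a ≢ b → ¬ a ⇝ b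
  imprints-incomparable ia ib a≢b = a≢b ∘ Imprint-minimal ib (proj₁ ia) (Imprint-IsGate ia)

  TreeGate : V → Set
  TreeGate v = InT v × IsGate v

  imprint-branch : ∀ {a v} → Imp a → a ⇝ v → TreeGate v
  imprint-branch ia a⇝v = ⇝-InT (proj₁ ia) a⇝v , IsGate-⇝ (proj₁ ia) (Imprint-IsGate ia) a⇝v

module Imprints (G : Graph) (isMedian : IsMedian G) (cube-free : CubeFree G) (T : RootedTree G)
                (gated : HasGatedBranches G T) (u : Graph.V G) where
  open Graph G renaming (sym to adj-sym)
  open Metric G isMedian
  open Levels u
  open RootedTree T
  open Branches G _≟_ T
  open Gates G isMedian T gated u

  module Entry {x s} (x∈T : InT x) (gx : IsGate x) (s∈T : InT s) (s≢r : s ≢ root) (gs : IsGate s)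
               (x⇝y : x ⇝ parent s) (s∉x : ¬ x ⇝ s) where
    y m : V
    y = parent s
    m = median u x s

    median-below : m ⋖ x × d m s ≡ d x y
    median-below = (d-one (proj₁ arith) , proj₁ (proj₂ arith)) , proj₂ (proj₂ arith)
      where
      I-xs : Interval G x s m
      I-xs = proj₁ (proj₂ (median-intervals u x s))

      I-su : Interval G s u m
      I-su = proj₂ (proj₂ (median-intervals u x s))

      -- d(s,x) = 1 + d(y,x), as y is the gate of s in branch(x).
      e₂ : d m x + d m s ≡ suc (d x y)
      e₂ = begin
        d m x + d m s ≡⟨ cong (_+ d m s) (d-sym m x) ⟩
        d x m + d m s ≡⟨ interval⇒sum I-xs ⟩
        d x s         ≡⟨ d-sym x s ⟩
        d s x         ≡⟨ outside-neighbour-gate x∈T s∉x x⇝y (parentAdj s s∈T s≢r) x here ⟩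
        suc (d y x)   ≡⟨ cong suc (d-sym y x) ⟩
        suc (d x y)   ∎

      -- 1 + d(u,s) = d(u,y) = d(u,x) + d(x,y), as s and x are gates.
      e₃ : suc (d m s + d u m) ≡ d u x + d x y
      e₃ = begin
        suc (d m s + d u m) ≡⟨ cong suc (cong₂ _+_ (d-sym m s) (d-sym u m)) ⟩
        suc (d s m + d m u) ≡⟨ cong suc (interval⇒sum I-su) ⟩
        suc (d s u)         ≡⟨ cong suc (d-sym s u) ⟩
        suc (d u s)         ≡⟨ proj₂ (IsGate-⋖ s∈T s≢r gs) ⟩
        d u y               ≡⟨ gx y x⇝y ⟩
        d u x + d x y       ∎

      arith : d m x ≡ 1 × suc (d u m) ≡ d u x × d m s ≡ d x y
      arith = fork-arithmetic (d u m) (d m x) (d m s) (d u x) (d x y)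
                (interval⇒sum (proj₁ (median-intervals u x s))) e₂ e₃

    -- m is no child z of x whose branch avoids s: then y would be the gate of s in branch(z),
    -- and d(x,y) = d(z,s) = 1 + d(y,z) = 2 + d(x,y).
    median-not-child : ∀ {z} → InT z → z ≢ root → parent z ≡ x → IsGate z → ¬ z ⇝ s → m ≢ z
    median-not-child {z} z∈T z≢r pz≡x gz s∉z m≡z = m≢1+n+m (d x y) (begin
      d x y             ≡⟨ sym (subst (λ v → d v s ≡ d x y) m≡z (proj₂ median-below)) ⟩
      d z s             ≡⟨ d-sym z s ⟩
      d s z             ≡⟨ outside-neighbour-gate z∈T s∉z z⇝y (parentAdj s s∈T s≢r) z here ⟩
      suc (d y z)       ≡⟨ cong suc (trans (d-sym y z) dzy) ⟩
      suc (suc (d x y)) ∎)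
      where
      z⇝y : z ⇝ y
      z⇝y = up z≢r (subst (_⇝ y) (sym pz≡x) x⇝y)

      dzy : d z y ≡ suc (d x y)
      dzy = +-cancelˡ-≡ (d u z) _ _ (begin
        d u z + d z y       ≡⟨ sym (gz y z⇝y) ⟩
        d u y               ≡⟨ gx y x⇝y ⟩
        d u x + d x y       ≡⟨ cong (_+ d x y) (sym (trans (proj₂ (IsGate-⋖ z∈T z≢r gz)) (cong (d u) pz≡x))) ⟩
        suc (d u z) + d x y ≡⟨ sym (+-suc (d u z) (d x y)) ⟩
        d u z + suc (d x y) ∎)

  -- No three-way fork: if x has distinct children z₁, z₂ that are gates and a gate s hangs off
  -- branch(x) outside the branches of z₁ and z₂, then z₁, z₂ and the median of u, x, s are
  -- three lower neighbours of x, which span a cube.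
  no-fork : ∀ {z₁ z₂ s} → TreeGate z₁ → TreeGate z₂ → TreeGate s → z₁ ≢ root → z₂ ≢ root → s ≢ root →
            z₁ ≢ z₂ → parent z₁ ≡ parent z₂ → parent z₁ ⇝ parent s → ¬ z₁ ⇝ s → ¬ z₂ ⇝ s → ⊥
  no-fork {z₁} {z₂} (z₁∈T , g₁) (z₂∈T , g₂) (s∈T , gs) z₁≢r z₂≢r s≢r z₁≢z₂ siblings x⇝y s∉z₁ s∉z₂ =
    cube-free (downward-cube (IsGate-⋖ z₁∈T z₁≢r g₁) z₂⋖x (proj₁ E.median-below) z₁≢z₂
                 (≢-sym (E.median-not-child z₁∈T z₁≢r refl g₁ s∉z₁))
                 (≢-sym (E.median-not-child z₂∈T z₂≢r (sym siblings) g₂ s∉z₂)))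
    where
    module E = Entry (parent∈T z₁ z₁∈T z₁≢r) (IsGate-parent z₁∈T z₁≢r g₁) s∈T s≢r gs x⇝y (s∉z₁ ∘ up z₁≢r)

    z₂⋖x : z₂ ⋖ parent z₁
    z₂⋖x = subst (z₂ ⋖_) (sym siblings) (IsGate-⋖ z₂∈T z₂≢r g₂)

  record Fork (a b : V) : Set where
    field
      za zb    : V
      a⇝za     : a ⇝ za
      b⇝zb     : b ⇝ zb
      za∉b     : ¬ b ⇝ za
      zb∉a     : ¬ a ⇝ zb
      za≢root  : za ≢ root
      zb≢root  : zb ≢ root
      siblings : parent za ≡ parent zb

  swap : ∀ {a b} → Fork a b → Fork b a
  swap F = record { za = zb ; zb = za ; a⇝za = b⇝zb ; b⇝zb = a⇝za ; za∉b = zb∉a ; zb∉a = za∉b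
                  ; za≢root = zb≢root ; zb≢root = za≢root ; siblings = sym siblings }
    where open Fork F

  -- Distinct imprints fork: branch(a) leaves branch(b) at some za, and the child zb of
  -- parent(za) on branch(b) is not on branch(a), as siblings on one branch coincide.
  fork : ∀ {a b} → Imp a → Imp b → a ≢ b → Fork a b
  fork {a} {b} ia ib a≢b with exit (proj₁ ib) (proj₁ ia) (imprints-incomparable ib ia (≢-sym a≢b))
  ... | za , a⇝za , za∉b , za≢r , b⇝x
      with child-towards b⇝x
             (λ x≡b → imprints-incomparable ia ib a≢b (subst (a ⇝_) x≡b (⇝-parent a⇝za za≢r)))
  ... | zb , b⇝zb , zb≢r , pzb≡pza =
    record { za = za ; zb = zb ; a⇝za = a⇝za ; b⇝zb = b⇝zb ; za∉b = za∉b ; zb∉a = zb∉a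
           ; za≢root = za≢r ; zb≢root = zb≢r ; siblings = sym pzb≡pza }
    where
    zb∉a : ¬ a ⇝ zb
    zb∉a a⇝zb = za∉b (subst (b ⇝_) (siblings-on-branch (proj₁ ia) a⇝zb a⇝za zb≢r za≢r pzb≡pza) b⇝zb)

  -- If the branch of a third imprint c passes through za, then a and c fork at or below
  -- parent(za), and the branch of b joins theirs through zb: a three-way fork.
  through-child : ∀ {a b c} → Imp a → Imp b → Imp c → c ≢ a → (F : Fork a b) → c ⇝ Fork.za F → ⊥
  through-child {a} {b} {c} ia ib ic c≢a F c⇝za =
    no-fork (imprint-branch ia a⇝ta) (imprint-branch ic c⇝tc) (imprint-branch ib b⇝zb)
            ta≢root tc≢root zb≢root ta≢tc siblings′ pta⇝pzb (zb∉a ∘ ⇝-trans a⇝ta) zb∉tc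
    where
    open Fork F
    open Fork (fork ia ic (c≢a ∘ sym)) using ()
      renaming (za to ta; zb to tc; a⇝za to a⇝ta; b⇝zb to c⇝tc; za∉b to ta∉c;
                za≢root to ta≢root; zb≢root to tc≢root; siblings to siblings′)

    ta≢tc : ta ≢ tc
    ta≢tc e = ta∉c (subst (c ⇝_) (sym e) c⇝tc)

    -- ta lies strictly below za on branch(a), since c passes through za but not through ta.
    pta⇝pzb : parent ta ⇝ parent zb
    pta⇝pzb with ⇝-linear a⇝ta a⇝za
    ... | inj₂ za⇝ta = ⊥-elim (ta∉c (⇝-trans c⇝za za⇝ta))
    ... | inj₁ ta⇝za with ⇝-step ta⇝za
    ...   | inj₁ za≡ta = ⊥-elim (ta∉c (subst (c ⇝_) za≡ta c⇝za))
    ...   | inj₂ (_ , pta⇝za) = subst (parent ta ⇝_) siblings (⇝-parent pta⇝za za≢root)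

    -- za and zb are siblings, so they cannot both lie on branch(c).
    zb∉tc : ¬ tc ⇝ zb
    zb∉tc tc⇝zb = za∉b (subst (b ⇝_) (sym za≡zb) b⇝zb)
      where
      za≡zb : za ≡ zb
      za≡zb = siblings-on-branch (proj₁ ic) c⇝za (⇝-trans c⇝tc tc⇝zb) za≢root zb≢root siblings

  -- Given the fork of a and b at x = parent(za), the branch of a third imprint c joins branch(x)
  -- through a vertex s outside it; s = za or s = zb is excluded by through-child, any other s
  -- by no-fork.
  module ThirdImprint {a b c} (ia : Imp a) (ib : Imp b) (ic : Imp c) (b≢c : b ≢ c) (a≢c : a ≢ c)
                      (F : Fork a b) where
    open Fork F

    x : V
    x = parent za

    a⇝x : a ⇝ x
    a⇝x = ⇝-parent a⇝za za≢root

    c∉x : ¬ x ⇝ c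
    c∉x = imprints-incomparable ia ic a≢c ∘ ⇝-trans a⇝x

    off-branch : ∀ {z s} → parent z ≡ x → ¬ x ⇝ s → s ≢ z → ¬ z ⇝ s
    off-branch pz≡x s∉x s≢z z⇝s with ⇝-step z⇝s
    ... | inj₁ s≡z = s≢z s≡z
    ... | inj₂ (_ , pz⇝s) = s∉x (subst (_⇝ _) pz≡x pz⇝s)

    contradiction : ⊥
    contradiction with exit (⇝-InT (proj₁ ia) a⇝x) (proj₁ ic) c∉x
    ... | s , c⇝s , s∉x , s≢r , x⇝ps with s ≟ za | s ≟ zb
    ... | yes refl | _ = through-child ia ib ic (≢-sym a≢c) F c⇝s
    ... | no _ | yes refl = through-child ib ia ic (≢-sym b≢c) (swap F) c⇝s
    ... | no s≢za | no s≢zb =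
      no-fork (imprint-branch ia a⇝za) (imprint-branch ib b⇝zb) (imprint-branch ic c⇝s)
              za≢root zb≢root s≢r (λ e → za∉b (subst (b ⇝_) (sym e) b⇝zb)) siblings x⇝ps
              (off-branch refl s∉x s≢za) (off-branch (sym siblings) s∉x s≢zb)

  no-three-imprints : ∀ {a b c} → Imp a → Imp b → Imp c → a ≢ b → b ≢ c → a ≢ c → ⊥
  no-three-imprints ia ib ic a≢b b≢c a≢c = ThirdImprint.contradiction ia ib ic b≢c a≢c (fork ia ib a≢b)

lemma18 : (G : Graph) → IsMedian G → CubeFree G →
    (T : RootedTree G) → HasGatedBranches G T →
    Quasigated G (RootedTree.InT T)
lemma18 G isMedian cube-free T gated u _ a b c ia ib ic
  with Metric._≟_ G isMedian a b | Metric._≟_ G isMedian b c | Metric._≟_ G isMedian a c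
... | yes a≡b | _ | _ = inj₁ a≡b
... | no _ | yes b≡c | _ = inj₂ (inj₁ b≡c)
... | no _ | no _ | yes a≡c = inj₂ (inj₂ a≡c)
... | no a≢b | no b≢c | no a≢c =
  ⊥-elim (Imprints.no-three-imprints G isMedian cube-free T gated u ia ib ic a≢b b≢c a≢c)
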